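{- Let $(a,b)$ be a loop-digraphic list of length $n$ with $a$ nonincreasing and $\sum_{i=1}^n a_i=m$, and suppose $(a,b)$ is not a minconvex list. Then for every permutation $\sigma$ of $\{1,\dots,n\}$, $N_1(\alpha,\alpha_\sigma)>N_1(a,b)$.
   Context: $(a,b)$ denotes $((a_1,b_1),\dots,(a_n,b_n))$ with nonnegative integers. A loop-digraph realization is an $n\times n$ $(0,1)$-matrix (adjacency matrix of a digraph on $v_1,\dots,v_n$ without multiple arcs, at most one loop per vertex) with row sums $b_i$ and column sums $a_i$; $(a,b)$ is loop-digraphic if one exists and $N_1(a,b)$ is the number of them. For $m\le n^2$, $\alpha=(\alpha_1,\dots,\alpha_n)$ is defined by $\alpha_i=\lfloor m/n\rfloor+1$ for $i\le m\bmod n$ and $\alpha_i=\lfloor m/n\rfloor$ otherwise. For a permutation $\sigma$, $\alpha_\sigma=(\alpha_{\sigma(1)},\dots,\alpha_{\sigma(n)})$, and a list of the form $(\alpha,\alpha_\sigma)$ is called a minconvex list. -}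

module Defs where

open import Data.Nat using (ℕ; zero; suc; _+_; _≤_; _<_; _<ᵇ_)
open import Data.Nat.DivMod using (_/_; _%_)
open import Data.Bool using (Bool; true; false; if_then_else_)
open import Data.Fin using (Fin; toℕ)
open import Data.Vec using (Vec; []; _∷_; lookup; tabulate; map; sum; transpose; allFin)
open import Data.List using (List; []; _∷_; length; filter; concatMap) renaming (map to lmap)
open import Data.Product using (Σ; ∃; _×_; _,_)
open import Data.Fin.Permutation using (Permutation′; _⟨$⟩ʳ_)
open import Relation.Binary.PropositionalEquality using (_≡_)
open import Relation.Nullary using (Dec; ¬_)
open import Relation.Nullary.Decidable using (_×-dec_)
open import Data.Vec.Properties using (≡-dec)
import Data.Nat.Properties as ℕP

bit : Bool → ℕ
bit true  = 1
bit false = 0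

-- an n×n (0,1)-matrix, as a vector of rows
Matrix : ℕ → Set
Matrix n = Vec (Vec Bool n) n

rowSums : ∀ {n} → Matrix n → Vec ℕ n
rowSums M = map (λ r → sum (map bit r)) M

colSums : ∀ {n} → Matrix n → Vec ℕ n
colSums M = rowSums (transpose M)

-- M is a loop-digraph realization of (a,b):
-- row sums b_i (out-degrees) and column sums a_i (in-degrees)
IsRealization : ∀ {n} → Vec ℕ n → Vec ℕ n → Matrix n → Set
IsRealization a b M = (rowSums M ≡ b) × (colSums M ≡ a)

isRealization? : ∀ {n} (a b : Vec ℕ n) (M : Matrix n) → Dec (IsRealization a b M)
isRealization? a b M = ≡-dec ℕP._≟_ (rowSums M) b ×-dec ≡-dec ℕP._≟_ (colSums M) a

LoopDigraphic : ∀ {n} → Vec ℕ n → Vec ℕ n → Set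
LoopDigraphic {n} a b = Σ (Matrix n) (IsRealization a b)

allVecs : {A : Set} → List A → (k : ℕ) → List (Vec A k)
allVecs xs zero    = [] ∷ []
allVecs xs (suc k) = concatMap (λ x → lmap (x ∷_) (allVecs xs k)) xs

allMatrices : (n : ℕ) → List (Matrix n)
allMatrices n = allVecs (allVecs (true ∷ false ∷ []) n) n

N₁ : ∀ {n} → Vec ℕ n → Vec ℕ n → ℕ
N₁ {n} a b = length (filter (isRealization? a b) (allMatrices n))

NonIncreasing : ∀ {n} → Vec ℕ n → Set
NonIncreasing {n} a = ∀ (i j : Fin n) → toℕ i ≤ toℕ j → lookup a j ≤ lookup a i

-- α for given n and m (indices 0-based: α_i = ⌊m/n⌋+1 iff i < m mod n)
α : (n m : ℕ) → Vec ℕ n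
α zero    m = []
α (suc k) m = tabulate (λ i → m / suc k + (if toℕ i <ᵇ m % suc k then 1 else 0))

permuteVec : ∀ {n} → Permutation′ n → Vec ℕ n → Vec ℕ n
permuteVec σ v = tabulate (λ i → lookup v (σ ⟨$⟩ʳ i))

IsMinconvex : ∀ {n} → Vec ℕ n → Vec ℕ n → Set
IsMinconvex {n} a b =
  ∃ λ m → (m ≤ n Data.Nat.* n) × ∃ λ (σ : Permutation′ n) → (a ≡ α n m) × (b ≡ permuteVec σ (α n m))

-- Fix all rows of a realization except rows i and j, where b_i > b_j. The columns holding exactly
-- one entry of the two rows may be split between them in C(d, x) ways, x of them going to row i;
-- as x > d / 2, moving one unit from b_i to b_j does not decrease this number, and increases it when
-- b_i ≥ b_j + 2. An explicit injection realizes this: swap the two rows on the shortest prefix in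
-- which row i has one more entry than row j. Such moves carry any row-sum vector to a balanced
-- vector (entries differing by at most one) with the same sum, and N₁ is symmetric under
-- transposition, so N₁(a, b) ≤ N₁(α, α_σ), strictly if a or b is unbalanced. If both are balanced,
-- then a = α because a is nonincreasing, and b is a permutation of α: the list is minconvex.
module Submission where

open import Data.Bool using (Bool; true; false; if_then_else_)
open import Data.Empty using (⊥; ⊥-elim)
open import Data.Fin using (Fin; zero; suc; toℕ)
open import Data.Fin.Permutation using (Permutation′; _⟨$⟩ʳ_; _∘ₚ_; flip; inverseʳ)
import Data.Fin.Permutation as Perm
open import Data.Fin.Properties using (all?; ¬∀⟶∃¬) renaming (_≟_ to _≟ᶠ_)
open import Data.List using (List; []; _∷_; length; filter; concatMap; cartesianProductWith; _++_)
  renaming (map to lmap)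
open import Data.List.Membership.Propositional using (_∈_)
open import Data.List.Membership.Propositional.Properties
  using (∈-++⁺ˡ; ∈-++⁺ʳ; ∈-++⁻; ∈-map⁻; ∈-filter⁺; ∈-filter⁻; ∈-∃++; ∈-cartesianProductWith⁺)
open import Data.List.Properties using (length-++; length-map)
import Data.List.Relation.Unary.All as All
open All using ([]; _∷_)
open import Data.List.Relation.Unary.AllPairs using ([]; _∷_)
open import Data.List.Relation.Unary.Any using (here; there)
open import Data.List.Relation.Unary.Unique.Propositional using (Unique)
open import Data.List.Relation.Unary.Unique.Propositional.Properties
  using (cartesianProductWith⁺; filter⁺) renaming (map⁺ to map⁺-unique)
open import Data.Nat using (ℕ; zero; suc; pred; >-nonZero; _+_; _*_; _∸_; _≤_; _<_; _≤?_; _<ᵇ_; z≤n; s≤s)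
open import Data.Nat.DivMod using (_/_; _%_; m≡m%n+[m/n]*n; m%n<n)
open import Data.Nat.Induction using (<-rec)
open import Data.Nat.Properties
open import Algebra.Properties.CommutativeSemigroup +-commutativeSemigroup
  using (interchange; xy∙z≈zy∙x; xy∙z≈xz∙y; x∙yz≈xz∙y; x∙yz≈y∙xz)
import Algebra.Properties.CommutativeMonoid.Sum +-0-commutativeMonoid as ∑
open import Data.Nat.Tactic.RingSolver using (solve-∀)
open import Data.Product using (_×_; _,_; proj₁; proj₂; ∃; ∃₂)
import Data.Product as Prod
open import Data.Sum using (_⊎_; inj₁; inj₂)
open import Data.Unit using (⊤; tt)
open import Data.Vec using (Vec; []; _∷_; lookup; map; sum; tabulate; zipWith; transpose; replicate; _⊛_; _[_]≔_)
import Data.Vec as Vec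
open import Data.Vec.Properties
  using ( lookup∘tabulate; tabulate∘lookup; tabulate-cong; lookup∘update; lookup∘update′; map-[]≔; lookup-map
        ; lookup-zipWith; ∷-injective; lookup-⊛; lookup-replicate; map-∘)
open import Defs
open import Function using (_∘_; _$_)
open import Function.Definitions using (Injective)
open import Relation.Binary.PropositionalEquality
open import Relation.Nullary using (¬_; yes; no)
open import Relation.Nullary.Decidable using (dec-true; dec-false)

lookup-ext : ∀ {A : Set} {n} {xs ys : Vec A n} → (∀ i → lookup xs i ≡ lookup ys i) → xs ≡ ys
lookup-ext {xs = xs} {ys} eq = trans (sym (tabulate∘lookup xs)) (trans (tabulate-cong eq) (tabulate∘lookup ys))

replaceTwo : ∀ {A : Set} {n} → Vec A n → Fin n → Fin n → A → A → Vec A n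
replaceTwo v i j x y = (v [ i ]≔ x) [ j ]≔ y

module _ {A : Set} {n} (v : Vec A n) {i j : Fin n} (x y : A) where

  lookup-replaceTwo-i : i ≢ j → lookup (replaceTwo v i j x y) i ≡ x
  lookup-replaceTwo-i i≢j = trans (lookup∘update′ i≢j (v [ i ]≔ x) y) (lookup∘update i v x)

  lookup-replaceTwo-j : lookup (replaceTwo v i j x y) j ≡ y
  lookup-replaceTwo-j = lookup∘update j (v [ i ]≔ x) y

  lookup-replaceTwo-other : ∀ {k} → k ≢ i → k ≢ j → lookup (replaceTwo v i j x y) k ≡ lookup v k
  lookup-replaceTwo-other k≢i k≢j = trans (lookup∘update′ k≢j (v [ i ]≔ x) y) (lookup∘update′ k≢i v x)

  map-replaceTwo : ∀ {B : Set} (f : A → B) → map f (replaceTwo v i j x y) ≡ replaceTwo (map f v) i j (f x) (f y)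
  map-replaceTwo f = trans (map-[]≔ f (v [ i ]≔ x) j) (cong (_[ j ]≔ f y) (map-[]≔ f v i))

zipWith-[]≔ : ∀ {A B C : Set} {n} (f : A → B → C) (v : Vec A n) (w : Vec B n) i x →
  zipWith f (v [ i ]≔ x) w ≡ zipWith f v w [ i ]≔ f x (lookup w i)
zipWith-[]≔ f (_ ∷ v) (_ ∷ w) zero    x = refl
zipWith-[]≔ f (u ∷ v) (z ∷ w) (suc i) x = cong (f u z ∷_) (zipWith-[]≔ f v w i x)

zipWith-replaceTwo : ∀ {A B C : Set} {n} (f : A → B → C) (v : Vec A n) (w : Vec B n) i j x y →
  zipWith f (replaceTwo v i j x y) w ≡ replaceTwo (zipWith f v w) i j (f x (lookup w i)) (f y (lookup w j))
zipWith-replaceTwo f v w i j x y =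
  trans (zipWith-[]≔ f (v [ i ]≔ x) w j y) (cong (_[ j ]≔ _) (zipWith-[]≔ f v w i x))

sum-[]≔ : ∀ {n} (v : Vec ℕ n) i x → sum (v [ i ]≔ x) + lookup v i ≡ sum v + x
sum-[]≔ (u ∷ v) zero    x = xy∙z≈zy∙x x (sum v) u
sum-[]≔ (u ∷ v) (suc i) x = begin
  u + sum (v [ i ]≔ x) + lookup v i   ≡⟨ +-assoc u _ _ ⟩
  u + (sum (v [ i ]≔ x) + lookup v i) ≡⟨ cong (u +_) (sum-[]≔ v i x) ⟩
  u + (sum v + x)                     ≡⟨ +-assoc u _ _ ⟨
  u + sum v + x                       ∎
  where open ≡-Reasoning

sum-replaceTwo : ∀ {n} (v : Vec ℕ n) {i j : Fin n} x y → i ≢ j →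
  sum (replaceTwo v i j x y) + (lookup v i + lookup v j) ≡ sum v + (x + y)
sum-replaceTwo v {i} {j} x y i≢j = begin
  sum (w [ j ]≔ y) + (lookup v i + lookup v j)  ≡⟨ x∙yz≈xz∙y (sum (w [ j ]≔ y)) (lookup v i) (lookup v j) ⟩
  sum (w [ j ]≔ y) + lookup v j + lookup v i    ≡⟨ cong (λ z → sum (w [ j ]≔ y) + z + lookup v i) wj≡vj ⟨
  sum (w [ j ]≔ y) + lookup w j + lookup v i    ≡⟨ cong (_+ lookup v i) (sum-[]≔ w j y) ⟩
  sum w + y + lookup v i                        ≡⟨ xy∙z≈xz∙y (sum w) y _ ⟩
  sum w + lookup v i + y                        ≡⟨ cong (_+ y) (sum-[]≔ v i x) ⟩
  sum v + x + y                                 ≡⟨ +-assoc (sum v) x y ⟩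
  sum v + (x + y)                               ∎
  where
  open ≡-Reasoning
  w = v [ i ]≔ x
  wj≡vj : lookup w j ≡ lookup v j
  wj≡vj = lookup∘update′ (i≢j ∘ sym) v x

moveUnit : ∀ {n} → Vec ℕ n → Fin n → Fin n → Vec ℕ n
moveUnit b i j = replaceTwo b i j (pred (lookup b i)) (suc (lookup b j))

sum-moveUnit : ∀ {n} (b : Vec ℕ n) {i j} → i ≢ j → 0 < lookup b i → sum (moveUnit b i j) ≡ sum b
sum-moveUnit b {i} {j} i≢j 0<bi = +-cancelʳ-≡ (lookup b i + lookup b j) _ _
  (trans (sum-replaceTwo b _ _ i≢j) (cong (sum b +_) (pred+suc 0<bi)))
  where
  pred+suc : ∀ {x y} → 0 < x → pred x + suc y ≡ x + y
  pred+suc {suc x} {y} _ = +-suc x y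

excess : ∀ {n} → Vec ℕ n → Vec ℕ n → ℕ
excess b t = sum (zipWith _∸_ b t)

excess-moveUnit : ∀ {n} (b t : Vec ℕ n) {i j} → i ≢ j → lookup t i < lookup b i → lookup b j < lookup t j →
  suc (excess (moveUnit b i j) t) ≡ excess b t
excess-moveUnit b t {i} {j} i≢j ti<bi bj<tj = +-cancelʳ-≡ d _ _ (begin
  suc (excess b′ t) + d                       ≡⟨ +-suc (excess b′ t) d ⟨
  excess b′ t + suc d                         ≡⟨ cong₂ (λ e z → sum e + z) (zipWith-replaceTwo _∸_ b t i j _ _)
                                                       (sym (trans (cong₂ _+_ ui≡1+d uj≡0) (+-identityʳ (suc d)))) ⟩
  sum (replaceTwo u i j d (suc (lookup b j) ∸ lookup t j)) + (lookup u i + lookup u j)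
                                              ≡⟨ sum-replaceTwo u _ _ i≢j ⟩
  sum u + (d + (suc (lookup b j) ∸ lookup t j)) ≡⟨ cong (λ z → sum u + (d + z)) (m≤n⇒m∸n≡0 bj<tj) ⟩
  sum u + (d + 0)                             ≡⟨ cong (sum u +_) (+-identityʳ d) ⟩
  sum u + d                                   ∎)
  where
  open ≡-Reasoning
  b′ = moveUnit b i j
  u = zipWith _∸_ b t
  d = pred (lookup b i) ∸ lookup t i
  ∸-pred : ∀ {x y} → y < x → x ∸ y ≡ suc (pred x ∸ y)
  ∸-pred {suc x} (s≤s y≤x) = +-∸-assoc 1 y≤x
  ui≡1+d : lookup u i ≡ suc d
  ui≡1+d = trans (lookup-zipWith _∸_ i b t) (∸-pred ti<bi)
  uj≡0 : lookup u j ≡ 0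
  uj≡0 = trans (lookup-zipWith _∸_ j b t) (m≤n⇒m∸n≡0 (<⇒≤ bj<tj))

sum-mono-≤ : ∀ {n} (b t : Vec ℕ n) → (∀ i → lookup b i ≤ lookup t i) → sum b ≤ sum t
sum-mono-≤ []      []      _   = z≤n
sum-mono-≤ (x ∷ b) (y ∷ t) b≤t = +-mono-≤ (b≤t zero) (sum-mono-≤ b t (b≤t ∘ suc))

pointwise-≤∧sum-≡⇒≡ : ∀ {n} (b t : Vec ℕ n) → (∀ i → lookup b i ≤ lookup t i) → sum b ≡ sum t →
  b ≡ t
pointwise-≤∧sum-≡⇒≡ []      []      _   _ = refl
pointwise-≤∧sum-≡⇒≡ (x ∷ b) (y ∷ t) b≤t Σ≡ =
  cong₂ _∷_ x≡y (pointwise-≤∧sum-≡⇒≡ b t (b≤t ∘ suc)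
    (+-cancelˡ-≡ x _ _ (trans Σ≡ (cong (_+ sum t) (sym x≡y)))))
  where
  x≡y : x ≡ y
  x≡y = ≤-antisym (b≤t zero)
          (+-cancelʳ-≤ (sum b) y x (≤-trans (+-monoʳ-≤ y (sum-mono-≤ b t (b≤t ∘ suc))) (≤-reflexive (sym Σ≡))))

pointwise-≤⊎surplus : ∀ {n} (b t : Vec ℕ n) →
  (∀ i → lookup b i ≤ lookup t i) ⊎ ∃ λ i → lookup t i < lookup b i
pointwise-≤⊎surplus b t with all? (λ i → lookup b i ≤? lookup t i)
... | yes b≤t = inj₁ b≤t
... | no  b≰t =
  let (i , bi≰ti) = ¬∀⟶∃¬ _ _ (λ i → lookup b i ≤? lookup t i) b≰t in inj₂ (i , ≰⇒> bi≰ti)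

≡⊎surplus×deficit : ∀ {n} (b t : Vec ℕ n) → sum b ≡ sum t →
  b ≡ t ⊎ ∃₂ λ i j → lookup t i < lookup b i × lookup b j < lookup t j
≡⊎surplus×deficit b t Σ≡ with pointwise-≤⊎surplus b t
... | inj₁ b≤t = inj₁ (pointwise-≤∧sum-≡⇒≡ b t b≤t Σ≡)
... | inj₂ (i , ti<bi) with pointwise-≤⊎surplus t b
...   | inj₁ t≤b         =
  ⊥-elim (<-irrefl (cong (λ v → lookup v i) (pointwise-≤∧sum-≡⇒≡ t b t≤b (sym Σ≡))) ti<bi)
...   | inj₂ (j , bj<tj) = inj₂ (i , j , ti<bi , bj<tj)

moveUnit-induction : ∀ {n} (t : Vec ℕ n) (P : Vec ℕ n → Set) → P t →
  (∀ b i j → lookup t i < lookup b i → lookup b j < lookup t j → P (moveUnit b i j) → P b) →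
  ∀ b → sum b ≡ sum t → P b
moveUnit-induction t P Pt step b Σ≡ = <-rec Q go (excess b t) b refl Σ≡
  where
  Q : ℕ → Set
  Q e = ∀ b → excess b t ≡ e → sum b ≡ sum t → P b
  go : ∀ e → (∀ {e′} → e′ < e → Q e′) → Q e
  go _ ih b refl Σ≡ with ≡⊎surplus×deficit b t Σ≡
  ... | inj₁ refl = Pt
  ... | inj₂ (i , j , ti<bi , bj<tj) =
    step b i j ti<bi bj<tj (ih (≤-reflexive (excess-moveUnit b t i≢j ti<bi bj<tj)) (moveUnit b i j) refl
      (trans (sum-moveUnit b i≢j (≤-<-trans z≤n ti<bi)) Σ≡))
    where
    i≢j : i ≢ j
    i≢j refl = <-asym ti<bi bj<tj

weight : ∀ {n} → Vec Bool n → ℕ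
weight r = sum (map bit r)

afterColumn : ℕ → Bool → Bool → ℕ
afterColumn h true  false = h
afterColumn h false true  = suc (suc h)
afterColumn h true  true  = suc h
afterColumn h false false = suc h

afterColumn-spec : ∀ h x y → bit x + afterColumn h x y ≡ bit y + suc h
afterColumn-spec h true  false = refl
afterColumn-spec h false true  = refl
afterColumn-spec h true  true  = refl
afterColumn-spec h false false = refl

-- SurplusReaches h r s: some prefix of the columns of (r, s) has h more (1,0)- than (0,1)-columns.
-- While scanning, the index is the part of that surplus still missing; afterColumn h x y is what
-- remains missing after the column (x, y) when suc h was.
SurplusReaches : ∀ {n} → ℕ → Vec Bool n → Vec Bool n → Set
SurplusReaches zero    _       _       = ⊤
SurplusReaches (suc h) []      []      = ⊥
SurplusReaches (suc h) (x ∷ r) (y ∷ s) = SurplusReaches (afterColumn h x y) r s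

-- Exchanges the two rows on the shortest prefix with surplus h.
swapPrefix : ∀ {n} → ℕ → Vec Bool n → Vec Bool n → Vec Bool n × Vec Bool n
swapPrefix zero    r       s       = r , s
swapPrefix (suc h) []      []      = [] , []
swapPrefix (suc h) (x ∷ r) (y ∷ s) = Prod.map (y ∷_) (x ∷_) (swapPrefix (afterColumn h x y) r s)

surplusReaches-weight : ∀ {n} h (r s : Vec Bool n) → weight s + h ≤ weight r → SurplusReaches h r s
surplusReaches-weight zero    r       s       _ = tt
surplusReaches-weight (suc h) []      []      ()
surplusReaches-weight (suc h) (x ∷ r) (y ∷ s) ws+h≤wr =
  surplusReaches-weight (afterColumn h x y) r s (+-cancelˡ-≤ (bit x) _ _ (begin
    bit x + (weight s + afterColumn h x y) ≡⟨ x∙yz≈y∙xz (bit x) (weight s) _ ⟩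
    weight s + (bit x + afterColumn h x y) ≡⟨ cong (weight s +_) (afterColumn-spec h x y) ⟩
    weight s + (bit y + suc h)             ≡⟨ x∙yz≈y∙xz (weight s) (bit y) (suc h) ⟩
    bit y + (weight s + suc h)             ≡⟨ +-assoc (bit y) (weight s) (suc h) ⟨
    bit y + weight s + suc h               ≤⟨ ws+h≤wr ⟩
    bit x + weight r                       ∎))
  where open ≤-Reasoning

swapPrefix-surplusReaches : ∀ {n} h (r s : Vec Bool n) → SurplusReaches h r s →
  SurplusReaches h (proj₂ (swapPrefix h r s)) (proj₁ (swapPrefix h r s))
swapPrefix-surplusReaches zero    r       s       _ = tt
swapPrefix-surplusReaches (suc h) []      []      ()
swapPrefix-surplusReaches (suc h) (x ∷ r) (y ∷ s) reaches =
  swapPrefix-surplusReaches (afterColumn h x y) r s reaches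

swapPrefix-weight : ∀ {n} h (r s : Vec Bool n) → SurplusReaches h r s →
  weight (proj₁ (swapPrefix h r s)) + h ≡ weight r × weight (proj₂ (swapPrefix h r s)) ≡ weight s + h
swapPrefix-weight zero    r       s       _ = +-identityʳ (weight r) , sym (+-identityʳ (weight s))
swapPrefix-weight (suc h) []      []      ()
swapPrefix-weight (suc h) (x ∷ r) (y ∷ s) reaches = first , second
  where
  open ≡-Reasoning
  c = afterColumn h x y
  r′ = proj₁ (swapPrefix c r s)
  s′ = proj₂ (swapPrefix c r s)
  ih = swapPrefix-weight c r s reaches
  first : bit y + weight r′ + suc h ≡ bit x + weight r
  first = begin
    bit y + weight r′ + suc h   ≡⟨ +-assoc (bit y) (weight r′) (suc h) ⟩
    bit y + (weight r′ + suc h) ≡⟨ x∙yz≈y∙xz (bit y) (weight r′) (suc h) ⟩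
    weight r′ + (bit y + suc h) ≡⟨ cong (weight r′ +_) (afterColumn-spec h x y) ⟨
    weight r′ + (bit x + c)     ≡⟨ x∙yz≈y∙xz (weight r′) (bit x) c ⟩
    bit x + (weight r′ + c)     ≡⟨ cong (bit x +_) (proj₁ ih) ⟩
    bit x + weight r            ∎
  second : bit x + weight s′ ≡ bit y + weight s + suc h
  second = begin
    bit x + weight s′           ≡⟨ cong (bit x +_) (proj₂ ih) ⟩
    bit x + (weight s + c)      ≡⟨ x∙yz≈y∙xz (bit x) (weight s) c ⟩
    weight s + (bit x + c)      ≡⟨ cong (weight s +_) (afterColumn-spec h x y) ⟩
    weight s + (bit y + suc h)  ≡⟨ x∙yz≈y∙xz (weight s) (bit y) (suc h) ⟩
    bit y + (weight s + suc h)  ≡⟨ +-assoc (bit y) (weight s) (suc h) ⟨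
    bit y + weight s + suc h    ∎

swapPrefix-column : ∀ {n} h (r s : Vec Bool n) k →
  bit (lookup (proj₁ (swapPrefix h r s)) k) + bit (lookup (proj₂ (swapPrefix h r s)) k)
    ≡ bit (lookup r k) + bit (lookup s k)
swapPrefix-column zero    r       s       k       = refl
swapPrefix-column (suc h) (x ∷ r) (y ∷ s) zero    = +-comm (bit y) (bit x)
swapPrefix-column (suc h) (x ∷ r) (y ∷ s) (suc k) = swapPrefix-column (afterColumn h x y) r s k

swapPrefix-injective : ∀ {n} h (r s r₂ s₂ : Vec Bool n) → swapPrefix h r s ≡ swapPrefix h r₂ s₂ →
  r ≡ r₂ × s ≡ s₂
swapPrefix-injective zero    r       s       r₂        s₂        refl = refl , refl
swapPrefix-injective (suc h) []      []      []        []        _    = refl , refl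
swapPrefix-injective (suc h) (x ∷ r) (y ∷ s) (x₂ ∷ r₂) (y₂ ∷ s₂) eq
  with ∷-injective (cong proj₁ eq) | ∷-injective (cong proj₂ eq)
... | refl , r′≡r₂′ | refl , s′≡s₂′
  with swapPrefix-injective (afterColumn h x y) r s r₂ s₂ (cong₂ _,_ r′≡r₂′ s′≡s₂′)
... | refl , refl = refl , refl

record UnitTransfer {n} (r s r′ s′ : Vec Bool n) : Set where
  field
    weight-from : weight r′ + 1 ≡ weight r
    weight-to   : weight s′ ≡ weight s + 1
    columns     : ∀ k → bit (lookup r′ k) + bit (lookup s′ k) ≡ bit (lookup r k) + bit (lookup s k)

swapPrefix-unitTransfer : ∀ {n} (r s : Vec Bool n) → weight s + 1 ≤ weight r →
  UnitTransfer r s (proj₁ (swapPrefix 1 r s)) (proj₂ (swapPrefix 1 r s))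
swapPrefix-unitTransfer r s ws+1≤wr = record
  { weight-from = proj₁ weights
  ; weight-to   = proj₂ weights
  ; columns     = swapPrefix-column 1 r s
  }
  where weights = swapPrefix-weight 1 r s (surplusReaches-weight 1 r s ws+1≤wr)

count10 : ∀ {n} → Vec Bool n → Vec Bool n → ℕ
count10 []         []          = 0
count10 (true ∷ r) (false ∷ s) = suc (count10 r s)
count10 (_ ∷ r)    (_ ∷ s)     = count10 r s

count01 : ∀ {n} → Vec Bool n → Vec Bool n → ℕ
count01 r s = count10 s r

weight-count : ∀ {n} (r s : Vec Bool n) → weight r + count01 r s ≡ weight s + count10 r s
weight-count []          []          = refl
weight-count (true ∷ r)  (false ∷ s) = trans (cong suc (weight-count r s)) (sym (+-suc (weight s) (count10 r s)))
weight-count (false ∷ r) (true ∷ s)  = trans (+-suc (weight r) (count01 r s)) (cong suc (weight-count r s))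
weight-count (true ∷ r)  (true ∷ s)  = cong suc (weight-count r s)
weight-count (false ∷ r) (false ∷ s) = weight-count r s

sortDifferences : ∀ {n} → ℕ → Vec Bool n → Vec Bool n → Vec Bool n × Vec Bool n
sortDifferences k       []          []          = [] , []
sortDifferences k       (true ∷ r)  (true ∷ s)  = Prod.map (true ∷_) (true ∷_) (sortDifferences k r s)
sortDifferences k       (false ∷ r) (false ∷ s) = Prod.map (false ∷_) (false ∷_) (sortDifferences k r s)
sortDifferences zero    (_ ∷ r)     (_ ∷ s)     = Prod.map (false ∷_) (true ∷_) (sortDifferences zero r s)
sortDifferences (suc k) (_ ∷ r)     (_ ∷ s)     = Prod.map (true ∷_) (false ∷_) (sortDifferences k r s)

sortDifferences-column : ∀ {n} k (r s : Vec Bool n) c →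
  bit (lookup (proj₁ (sortDifferences k r s)) c) + bit (lookup (proj₂ (sortDifferences k r s)) c)
    ≡ bit (lookup r c) + bit (lookup s c)
sortDifferences-column k       (true ∷ r)  (true ∷ s)  zero    = refl
sortDifferences-column k       (false ∷ r) (false ∷ s) zero    = refl
sortDifferences-column zero    (true ∷ r)  (false ∷ s) zero    = refl
sortDifferences-column zero    (false ∷ r) (true ∷ s)  zero    = refl
sortDifferences-column (suc k) (true ∷ r)  (false ∷ s) zero    = refl
sortDifferences-column (suc k) (false ∷ r) (true ∷ s)  zero    = refl
sortDifferences-column k       (true ∷ r)  (true ∷ s)  (suc c) = sortDifferences-column k r s c
sortDifferences-column k       (false ∷ r) (false ∷ s) (suc c) = sortDifferences-column k r s c
sortDifferences-column zero    (true ∷ r)  (false ∷ s) (suc c) = sortDifferences-column zero r s c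
sortDifferences-column zero    (false ∷ r) (true ∷ s)  (suc c) = sortDifferences-column zero r s c
sortDifferences-column (suc k) (true ∷ r)  (false ∷ s) (suc c) = sortDifferences-column k r s c
sortDifferences-column (suc k) (false ∷ r) (true ∷ s)  (suc c) = sortDifferences-column k r s c

sortDifferences-weight : ∀ {n} k (r s : Vec Bool n) → k ≤ count10 r s + count01 r s →
  weight (proj₁ (sortDifferences k r s)) + count10 r s ≡ weight r + k ×
  weight (proj₂ (sortDifferences k r s)) + k ≡ weight s + count10 r s
sortDifferences-weight k []          []          z≤n = refl , refl
sortDifferences-weight k (true ∷ r)  (true ∷ s)  k≤d = Prod.map (cong suc) (cong suc) (sortDifferences-weight k r s k≤d)
sortDifferences-weight k (false ∷ r) (false ∷ s) k≤d = sortDifferences-weight k r s k≤d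
sortDifferences-weight zero (true ∷ r) (false ∷ s) _ =
  let (w₁ , w₂) = sortDifferences-weight zero r s z≤n
  in trans (+-suc _ _) (cong suc w₁) , trans (cong suc w₂) (sym (+-suc _ _))
sortDifferences-weight zero (false ∷ r) (true ∷ s) _ =
  let (w₁ , w₂) = sortDifferences-weight zero r s z≤n in w₁ , cong suc w₂
sortDifferences-weight (suc k) (true ∷ r) (false ∷ s) (s≤s k≤d) =
  let (w₁ , w₂) = sortDifferences-weight k r s k≤d
  in cong suc (trans (+-suc _ (count10 r s)) (trans (cong suc w₁) (sym (+-suc (weight r) k)))) ,
     trans (+-suc _ k) (trans (cong suc w₂) (sym (+-suc (weight s) (count10 r s))))
sortDifferences-weight (suc k) (false ∷ r) (true ∷ s) k<d =
  let (w₁ , w₂) = sortDifferences-weight k r s (≤-pred (subst (suc k ≤_) (+-suc _ _) k<d))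
  in trans (cong suc w₁) (sym (+-suc _ _)) , trans (+-suc _ _) (cong suc w₂)

private
  two-more : ∀ h k → suc h + (suc k + suc k) ≡ suc (suc (suc h)) + (k + k)
  two-more = solve-∀

sortDifferences-¬surplusReaches : ∀ {n} h k (r s : Vec Bool n) → count10 r s + count01 r s < suc h + (k + k) →
  ¬ SurplusReaches (suc h) (proj₂ (sortDifferences k r s)) (proj₁ (sortDifferences k r s))
sortDifferences-¬surplusReaches h k [] [] _ ()
sortDifferences-¬surplusReaches h k (true ∷ r)  (true ∷ s)  d< = sortDifferences-¬surplusReaches h k r s d<
sortDifferences-¬surplusReaches h k (false ∷ r) (false ∷ s) d< = sortDifferences-¬surplusReaches h k r s d<
sortDifferences-¬surplusReaches zero zero (true ∷ r) (false ∷ s) (s≤s ())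
sortDifferences-¬surplusReaches (suc h) zero (true ∷ r) (false ∷ s) (s≤s d<) =
  sortDifferences-¬surplusReaches h zero r s d<
sortDifferences-¬surplusReaches zero zero (false ∷ r) (true ∷ s) (s≤s d<) with () ← subst (_≤ 0) (+-suc _ _) d<
sortDifferences-¬surplusReaches (suc h) zero (false ∷ r) (true ∷ s) (s≤s d<) =
  sortDifferences-¬surplusReaches h zero r s (subst (_≤ suc h + 0) (+-suc _ _) d<)
sortDifferences-¬surplusReaches h (suc k) (true ∷ r) (false ∷ s) d< =
  sortDifferences-¬surplusReaches (suc h) k r s (≤-pred (subst (suc (suc (count10 r s + count01 r s)) ≤_) (two-more h k) d<))
sortDifferences-¬surplusReaches h (suc k) (false ∷ r) (true ∷ s) d< =
  sortDifferences-¬surplusReaches (suc h) k r s (≤-pred (subst₂ _≤_ (cong suc (+-suc _ _)) (two-more h k) d<))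

unreachableTransfer : ∀ {n} (r s : Vec Bool n) → weight s + 2 ≤ weight r →
  ∃₂ λ r′ s′ → UnitTransfer r s r′ s′ × ¬ SurplusReaches 1 s′ r′
unreachableTransfer r s ws+2≤wr = r′ , s′ , transfer , sortDifferences-¬surplusReaches 0 k r s d<1+2k
  where
  open ≤-Reasoning
  p = count10 r s
  q = count01 r s
  q+2≤p : q + 2 ≤ p
  q+2≤p = +-cancelˡ-≤ (weight s) _ _ (begin
    weight s + (q + 2) ≡⟨ x∙yz≈xz∙y (weight s) q 2 ⟩
    weight s + 2 + q   ≤⟨ +-monoˡ-≤ q ws+2≤wr ⟩
    weight r + q       ≡⟨ weight-count r s ⟩
    weight s + p       ∎)
  k = pred p
  p≡1+k : p ≡ suc k
  p≡1+k = sym (suc-pred p {{>-nonZero (≤-trans (s≤s z≤n) (≤-trans (m≤n+m 2 q) q+2≤p))}})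
  q<k : q < k
  q<k = ≤-pred (subst (2 + q ≤_) p≡1+k (subst (_≤ p) (+-comm q 2) q+2≤p))
  d<1+2k : p + q < 1 + (k + k)
  d<1+2k = s≤s (subst (λ x → x + q ≤ k + k) (sym p≡1+k) (subst (_≤ k + k) (+-suc k q) (+-monoʳ-≤ k q<k)))
  r′ = proj₁ (sortDifferences k r s)
  s′ = proj₂ (sortDifferences k r s)
  weights = sortDifferences-weight k r s (≤-trans (≤-trans (n≤1+n k) (≤-reflexive (sym p≡1+k))) (m≤m+n p q))
  transfer : UnitTransfer r s r′ s′
  transfer = record
    { weight-from = +-cancelʳ-≡ k _ _
        (trans (+-assoc (weight r′) 1 k) (trans (cong (weight r′ +_) (sym p≡1+k)) (proj₁ weights)))
    ; weight-to   = +-cancelʳ-≡ k _ _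
        (trans (proj₂ weights) (trans (cong (weight s +_) p≡1+k) (sym (+-assoc (weight s) 1 k))))
    ; columns     = sortDifferences-column k r s
    }

concatMap-cons : ∀ {A : Set} {k} (xs : List A) (L : List (Vec A k)) →
  concatMap (λ x → lmap (x ∷_) L) xs ≡ cartesianProductWith _∷_ xs L
concatMap-cons []       L = refl
concatMap-cons (x ∷ xs) L = cong (lmap (x ∷_) L ++_) (concatMap-cons xs L)

allVecs-unique : ∀ {A : Set} {xs : List A} → Unique xs → ∀ k → Unique (allVecs xs k)
allVecs-unique u zero    = [] ∷ []
allVecs-unique {xs = xs} u (suc k) =
  subst Unique (sym (concatMap-cons xs (allVecs xs k))) (cartesianProductWith⁺ _∷_ ∷-injective u (allVecs-unique u k))

allVecs-complete : ∀ {A : Set} {xs : List A} → (∀ x → x ∈ xs) → ∀ k (v : Vec A k) → v ∈ allVecs xs k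
allVecs-complete xs-complete zero    []      = here refl
allVecs-complete {xs = xs} xs-complete (suc k) (x ∷ v) =
  subst (x ∷ v ∈_) (sym (concatMap-cons xs (allVecs xs k)))
    (∈-cartesianProductWith⁺ _∷_ (xs-complete x) (allVecs-complete xs-complete k v))

allMatrices-unique : ∀ n → Unique (allMatrices n)
allMatrices-unique n = allVecs-unique (allVecs-unique (((λ ()) ∷ []) ∷ [] ∷ []) n) n

allMatrices-complete : ∀ n (M : Matrix n) → M ∈ allMatrices n
allMatrices-complete n = allVecs-complete (allVecs-complete Bool-complete n) n
  where
  Bool-complete : ∀ x → x ∈ true ∷ false ∷ []
  Bool-complete true  = here refl
  Bool-complete false = there (here refl)

unique-⊆⇒length-≤ : ∀ {A : Set} (xs ys : List A) → Unique xs → (∀ {x} → x ∈ xs → x ∈ ys) →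
  length xs ≤ length ys
unique-⊆⇒length-≤ []       ys _                 _     = z≤n
unique-⊆⇒length-≤ (x ∷ xs) ys (x∉xs ∷ xs-unique) xs⊆ys with ∈-∃++ (xs⊆ys (here refl))
... | ys₁ , ys₂ , refl = begin
  suc (length xs)             ≤⟨ s≤s (unique-⊆⇒length-≤ xs (ys₁ ++ ys₂) xs-unique xs⊆ys₁++ys₂) ⟩
  suc (length (ys₁ ++ ys₂))   ≡⟨ cong suc (length-++ ys₁) ⟩
  suc (length ys₁ + length ys₂) ≡⟨ +-suc (length ys₁) (length ys₂) ⟨
  length ys₁ + suc (length ys₂) ≡⟨ length-++ ys₁ ⟨
  length (ys₁ ++ x ∷ ys₂)     ∎
  where
  open ≤-Reasoning
  xs⊆ys₁++ys₂ : ∀ {y} → y ∈ xs → y ∈ ys₁ ++ ys₂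
  xs⊆ys₁++ys₂ y∈xs with ∈-++⁻ ys₁ (xs⊆ys (there y∈xs))
  ... | inj₁ y∈ys₁         = ∈-++⁺ˡ y∈ys₁
  ... | inj₂ (here refl)   = ⊥-elim (All.lookup x∉xs y∈xs refl)
  ... | inj₂ (there y∈ys₂) = ∈-++⁺ʳ ys₁ y∈ys₂

module _ {n} {a b c d : Vec ℕ n} (F : Matrix n → Matrix n) (F-injective : Injective _≡_ _≡_ F)
         (F-realizes : ∀ M → IsRealization a b M → IsRealization c d (F M)) where

  private
    realizations : Vec ℕ n → Vec ℕ n → List (Matrix n)
    realizations x y = filter (isRealization? x y) (allMatrices n)

    image : List (Matrix n)
    image = lmap F (realizations a b)

    image-unique : Unique image
    image-unique = map⁺-unique F-injective (filter⁺ (isRealization? a b) (allMatrices-unique n))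

    image-⊆ : ∀ {M} → M ∈ image → M ∈ realizations c d
    image-⊆ M∈image with ∈-map⁻ F M∈image
    ... | M , M∈ , refl =
      ∈-filter⁺ (isRealization? c d) (allMatrices-complete n (F M))
        (F-realizes M (proj₂ (∈-filter⁻ (isRealization? a b) {xs = allMatrices n} M∈)))

  N₁-≤-injection : N₁ a b ≤ N₁ c d
  N₁-≤-injection = subst (_≤ N₁ c d) (length-map F (realizations a b))
    (unique-⊆⇒length-≤ image (realizations c d) image-unique image-⊆)

  N₁-<-injection : (W : Matrix n) → IsRealization c d W → (∀ M → IsRealization a b M → F M ≢ W) →
    N₁ a b < N₁ c d
  N₁-<-injection W W-realizes W∉image = subst (λ k → suc k ≤ N₁ c d) (length-map F (realizations a b))
    (unique-⊆⇒length-≤ (W ∷ image) (realizations c d) (All.tabulate W≢ ∷ image-unique) W∷image-⊆)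
    where
    W≢ : ∀ {M} → M ∈ image → W ≢ M
    W≢ M∈image W≡M with ∈-map⁻ F M∈image
    ... | M , M∈ , refl = W∉image M (proj₂ (∈-filter⁻ (isRealization? a b) {xs = allMatrices n} M∈)) (sym W≡M)
    W∷image-⊆ : ∀ {M} → M ∈ W ∷ image → M ∈ realizations c d
    W∷image-⊆ (here refl)     = ∈-filter⁺ (isRealization? c d) (allMatrices-complete n W) W-realizes
    W∷image-⊆ (there M∈image) = image-⊆ M∈image

lookup-transpose : ∀ {A : Set} {m n} (M : Vec (Vec A n) m) k → lookup (transpose M) k ≡ map (λ r → lookup r k) M
lookup-transpose []      k = lookup-replicate k []
lookup-transpose {m = suc m} (r ∷ M) k = begin
  lookup ((replicate _ cons ⊛ r) ⊛ transpose M) k        ≡⟨ lookup-⊛ k (replicate _ cons ⊛ r) (transpose M) ⟩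
  lookup (replicate _ cons ⊛ r) k (lookup (transpose M) k) ≡⟨ cong₂ _$_ (trans (lookup-⊛ k (replicate _ cons) r)
                                                             (cong (_$ lookup r k) (lookup-replicate k cons)))
                                                             (lookup-transpose M k) ⟩
  lookup r k ∷ map (λ r → lookup r k) M                  ∎
  where
  open ≡-Reasoning
  cons = Vec._∷_ {n = m}

transpose-involutive : ∀ {A : Set} {m n} (M : Vec (Vec A n) m) → transpose (transpose M) ≡ M
transpose-involutive M = lookup-ext λ i → lookup-ext λ j → begin
  lookup (lookup (transpose (transpose M)) i) j   ≡⟨ cong (λ v → lookup v j) (lookup-transpose (transpose M) i) ⟩
  lookup (map (λ r → lookup r i) (transpose M)) j ≡⟨ lookup-map j _ (transpose M) ⟩
  lookup (lookup (transpose M) j) i               ≡⟨ cong (λ v → lookup v i) (lookup-transpose M j) ⟩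
  lookup (map (λ r → lookup r j) M) i             ≡⟨ lookup-map i _ M ⟩
  lookup (lookup M i) j                           ∎
  where open ≡-Reasoning

transpose-realization : ∀ {n} {a b : Vec ℕ n} {M : Matrix n} → IsRealization a b M → IsRealization b a (transpose M)
transpose-realization {M = M} (rows , cols) = cols , trans (cong rowSums (transpose-involutive M)) rows

N₁-≤-swap : ∀ {n} (a b : Vec ℕ n) → N₁ a b ≤ N₁ b a
N₁-≤-swap a b = N₁-≤-injection {a = a} {b} {b} {a} transpose
  (λ {M} {M′} eq → trans (sym (transpose-involutive M)) (trans (cong transpose eq) (transpose-involutive M′)))
  (λ M → transpose-realization)

N₁-comm : ∀ {n} (a b : Vec ℕ n) → N₁ a b ≡ N₁ b a
N₁-comm a b = ≤-antisym (N₁-≤-swap a b) (N₁-≤-swap b a)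

lookup-rowSums : ∀ {n} (M : Matrix n) i → lookup (rowSums M) i ≡ weight (lookup M i)
lookup-rowSums M i = lookup-map i weight M

lookup-colSums : ∀ {n} (M : Matrix n) k → lookup (colSums M) k ≡ sum (map (λ r → bit (lookup r k)) M)
lookup-colSums M k = begin
  lookup (map weight (transpose M)) k         ≡⟨ lookup-map k weight (transpose M) ⟩
  weight (lookup (transpose M) k)             ≡⟨ cong weight (lookup-transpose M k) ⟩
  sum (map bit (map (λ r → lookup r k) M))    ≡⟨ cong sum (map-∘ bit (λ r → lookup r k) M) ⟨
  sum (map (λ r → bit (lookup r k)) M)        ∎
  where open ≡-Reasoning

realization-weight : ∀ {n} {a b : Vec ℕ n} {M : Matrix n} → IsRealization a b M →
  ∀ i → weight (lookup M i) ≡ lookup b i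
realization-weight {M = M} (rows , _) i = trans (sym (lookup-rowSums M i)) (cong (λ v → lookup v i) rows)

unitTransfer-realization : ∀ {n} {a b : Vec ℕ n} {M : Matrix n} {i j r′ s′} → i ≢ j → IsRealization a b M →
  UnitTransfer (lookup M i) (lookup M j) r′ s′ → IsRealization a (moveUnit b i j) (replaceTwo M i j r′ s′)
unitTransfer-realization {a = a} {b} {M} {i} {j} {r′} {s′} i≢j R@(rows , cols) transfer = rows′ , cols′
  where
  open UnitTransfer transfer
  rows′ : rowSums (replaceTwo M i j r′ s′) ≡ moveUnit b i j
  rows′ = begin
    rowSums (replaceTwo M i j r′ s′)
      ≡⟨ map-replaceTwo M r′ s′ weight ⟩
    replaceTwo (rowSums M) i j (weight r′) (weight s′)
      ≡⟨ cong₂ (replaceTwo (rowSums M) i j) weight-r′ weight-s′ ⟩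
    replaceTwo (rowSums M) i j (pred (lookup b i)) (suc (lookup b j))
      ≡⟨ cong (λ v → replaceTwo v i j _ _) rows ⟩
    moveUnit b i j
      ∎
    where
    open ≡-Reasoning
    weight-r′ : weight r′ ≡ pred (lookup b i)
    weight-r′ = cong pred (trans (+-comm 1 (weight r′)) (trans weight-from (realization-weight R i)))
    weight-s′ : weight s′ ≡ suc (lookup b j)
    weight-s′ = trans weight-to (trans (+-comm (weight (lookup M j)) 1) (cong suc (realization-weight R j)))
  column : ∀ k → let g = λ (r : Vec Bool _) → bit (lookup r k) in
    sum (map g (replaceTwo M i j r′ s′)) ≡ sum (map g M)
  column k = +-cancelʳ-≡ (g (lookup M i) + g (lookup M j)) _ _ (begin
    sum (map g (replaceTwo M i j r′ s′)) + (g (lookup M i) + g (lookup M j))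
      ≡⟨ cong₂ (λ v z → sum v + z) (map-replaceTwo M r′ s′ g)
               (sym (cong₂ _+_ (lookup-map i g M) (lookup-map j g M))) ⟩
    sum (replaceTwo (map g M) i j (g r′) (g s′)) + (lookup (map g M) i + lookup (map g M) j)
      ≡⟨ sum-replaceTwo (map g M) (g r′) (g s′) i≢j ⟩
    sum (map g M) + (g r′ + g s′)
      ≡⟨ cong (sum (map g M) +_) (columns k) ⟩
    sum (map g M) + (g (lookup M i) + g (lookup M j)) ∎)
    where
    open ≡-Reasoning
    g = λ (r : Vec Bool _) → bit (lookup r k)
  cols′ : colSums (replaceTwo M i j r′ s′) ≡ a
  cols′ = trans (lookup-ext λ k → trans (lookup-colSums (replaceTwo M i j r′ s′) k)
                                     (trans (column k) (sym (lookup-colSums M k)))) cols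

realization-gap : ∀ {n} {a b : Vec ℕ n} {M : Matrix n} {i j} h → IsRealization a b M →
  h + lookup b j ≤ lookup b i → weight (lookup M j) + h ≤ weight (lookup M i)
realization-gap {b = b} {i = i} {j} h R gap =
  subst₂ _≤_ (trans (+-comm h (lookup b j)) (cong (_+ h) (sym (realization-weight R j)))) (sym (realization-weight R i)) gap

gap⇒≢ : ∀ {n} (b : Vec ℕ n) {i j} → lookup b j < lookup b i → i ≢ j
gap⇒≢ b bj<bi refl = <-irrefl refl bj<bi

module _ {n} {i j : Fin n} (i≢j : i ≢ j) where

  transferRows : Matrix n → Matrix n
  transferRows M = replaceTwo M i j (proj₁ (swapPrefix 1 (lookup M i) (lookup M j)))
                                    (proj₂ (swapPrefix 1 (lookup M i) (lookup M j)))

  transferRows-injective : Injective _≡_ _≡_ transferRows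
  transferRows-injective {M} {M′} eq = lookup-ext row
    where
    rows-equal = swapPrefix-injective 1 _ _ _ _ (cong₂ _,_
      (trans (sym (lookup-replaceTwo-i M _ _ i≢j)) (trans (cong (λ X → lookup X i) eq) (lookup-replaceTwo-i M′ _ _ i≢j)))
      (trans (sym (lookup-replaceTwo-j M _ _)) (trans (cong (λ X → lookup X j) eq) (lookup-replaceTwo-j M′ _ _))))
    row : ∀ k → lookup M k ≡ lookup M′ k
    row k with k ≟ᶠ i | k ≟ᶠ j
    ... | yes refl | _        = proj₁ rows-equal
    ... | no _     | yes refl = proj₂ rows-equal
    ... | no k≢i   | no k≢j   = trans (sym (lookup-replaceTwo-other M _ _ k≢i k≢j))
                                  (trans (cong (λ X → lookup X k) eq) (lookup-replaceTwo-other M′ _ _ k≢i k≢j))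

  transferRows-surplusReaches : ∀ M → weight (lookup M j) + 1 ≤ weight (lookup M i) →
    SurplusReaches 1 (lookup (transferRows M) j) (lookup (transferRows M) i)
  transferRows-surplusReaches M gap =
    subst₂ (SurplusReaches 1) (sym (lookup-replaceTwo-j M _ _)) (sym (lookup-replaceTwo-i M _ _ i≢j))
      (swapPrefix-surplusReaches 1 (lookup M i) (lookup M j) (surplusReaches-weight 1 (lookup M i) (lookup M j) gap))

  transferRows-realization : ∀ {a b : Vec ℕ n} M → lookup b j < lookup b i →
    IsRealization a b M → IsRealization a (moveUnit b i j) (transferRows M)
  transferRows-realization M bj<bi R =
    unitTransfer-realization i≢j R (swapPrefix-unitTransfer _ _ (realization-gap 1 R bj<bi))

N₁-moveUnit-≤ : ∀ {n} (a b : Vec ℕ n) {i j} → lookup b j < lookup b i → N₁ a b ≤ N₁ a (moveUnit b i j)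
N₁-moveUnit-≤ a b bj<bi = N₁-≤-injection (transferRows i≢j) (transferRows-injective i≢j)
  (λ M → transferRows-realization i≢j M bj<bi)
  where i≢j = gap⇒≢ b bj<bi

-- Rows j and i of every matrix in the image of transferRows reach surplus 1; those of the
-- realization built from unreachableTransfer do not.
N₁-moveUnit-< : ∀ {n} {a b : Vec ℕ n} {i j} → LoopDigraphic a b → 2 + lookup b j ≤ lookup b i →
  N₁ a b < N₁ a (moveUnit b i j)
N₁-moveUnit-< {a = a} {b} {i} {j} (M₀ , R₀) gap
  with unreachableTransfer (lookup M₀ i) (lookup M₀ j) (realization-gap 2 R₀ gap)
... | r′ , s′ , transfer , ¬reaches =
  N₁-<-injection (transferRows i≢j) (transferRows-injective i≢j) (λ M → transferRows-realization i≢j M bj<bi)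
    W (unitTransfer-realization i≢j R₀ transfer) W∉image
  where
  bj<bi = ≤-trans (n≤1+n _) gap
  i≢j = gap⇒≢ b bj<bi
  W = replaceTwo M₀ i j r′ s′
  W∉image : ∀ M → IsRealization a b M → transferRows i≢j M ≢ W
  W∉image M R eq = ¬reaches (subst₂ (SurplusReaches 1)
    (trans (cong (λ X → lookup X j) eq) (lookup-replaceTwo-j M₀ r′ s′))
    (trans (cong (λ X → lookup X i) eq) (lookup-replaceTwo-i M₀ r′ s′ i≢j))
    (transferRows-surplusReaches i≢j M (realization-gap 1 R bj<bi)))

sum-tabulate : ∀ {n} (f : Fin n → ℕ) → sum (tabulate f) ≡ ∑.sum f
sum-tabulate {zero}  f = refl
sum-tabulate {suc n} f = cong (f zero +_) (sum-tabulate (f ∘ suc))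

sum≡∑lookup : ∀ {n} (v : Vec ℕ n) → sum v ≡ ∑.sum (lookup v)
sum≡∑lookup v = trans (cong sum (sym (tabulate∘lookup v))) (sum-tabulate (lookup v))

sum-colSums : ∀ {n} (M : Matrix n) → sum (colSums M) ≡ sum (rowSums M)
sum-colSums {n} M = begin
  sum (colSums M)                               ≡⟨ sum≡∑lookup (colSums M) ⟩
  ∑.sum (lookup (colSums M))                    ≡⟨ ∑.sum-cong-≗ column ⟩
  ∑.sum (λ k → ∑.sum (λ r → entry r k))         ≡⟨ ∑.∑-comm (λ k r → entry r k) ⟩
  ∑.sum (λ r → ∑.sum (λ k → entry r k))         ≡⟨ ∑.sum-cong-≗ row ⟨
  ∑.sum (lookup (rowSums M))                    ≡⟨ sum≡∑lookup (rowSums M) ⟨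
  sum (rowSums M)                               ∎
  where
  open ≡-Reasoning
  entry : Fin n → Fin n → ℕ
  entry r k = bit (lookup (lookup M r) k)
  row : ∀ r → lookup (rowSums M) r ≡ ∑.sum (entry r)
  row r = trans (lookup-rowSums M r) (trans (sum≡∑lookup (map bit (lookup M r)))
            (∑.sum-cong-≗ λ k → lookup-map k bit (lookup M r)))
  column : ∀ k → lookup (colSums M) k ≡ ∑.sum (λ r → entry r k)
  column k = trans (lookup-colSums M k) (trans (sum≡∑lookup (map (λ r → bit (lookup r k)) M))
               (∑.sum-cong-≗ λ r → lookup-map r (λ r → bit (lookup r k)) M))

realization-sum : ∀ {n} {a b : Vec ℕ n} → LoopDigraphic a b → sum b ≡ sum a
realization-sum (M , rows , cols) = trans (cong sum (sym rows)) (trans (sym (sum-colSums M)) (cong sum cols))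

weight-≤ : ∀ {n} (r : Vec Bool n) → weight r ≤ n
weight-≤ []          = z≤n
weight-≤ (true ∷ r)  = s≤s (weight-≤ r)
weight-≤ (false ∷ r) = m≤n⇒m≤1+n (weight-≤ r)

sum-≤-* : ∀ {n} c (v : Vec ℕ n) → (∀ i → lookup v i ≤ c) → sum v ≤ n * c
sum-≤-* c []      _    = z≤n
sum-≤-* c (x ∷ v) v≤c = +-mono-≤ (v≤c zero) (sum-≤-* c v (v≤c ∘ suc))

realization-sum-≤ : ∀ {n} {a b : Vec ℕ n} → LoopDigraphic a b → sum b ≤ n * n
realization-sum-≤ {n} (M , rows , _) = subst (λ v → sum v ≤ n * n) rows
  (sum-≤-* n (rowSums M) λ i → subst (_≤ n) (sym (lookup-rowSums M i)) (weight-≤ (lookup M i)))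

Balanced : ∀ {n} → Vec ℕ n → Set
Balanced v = ∀ i j → lookup v i ≤ suc (lookup v j)

Unbalanced : ∀ {n} → Vec ℕ n → Set
Unbalanced v = ∃₂ λ i j → 2 + lookup v j ≤ lookup v i

balanced⊎unbalanced : ∀ {n} (v : Vec ℕ n) → Balanced v ⊎ Unbalanced v
balanced⊎unbalanced v with all? (λ i → all? (λ j → lookup v i ≤? suc (lookup v j)))
... | yes balanced = inj₁ balanced
... | no unbalanced with ¬∀⟶∃¬ _ _ (λ i → all? (λ j → lookup v i ≤? suc (lookup v j))) unbalanced
...   | i , ¬vi≤ with ¬∀⟶∃¬ _ _ (λ j → lookup v i ≤? suc (lookup v j)) ¬vi≤
...     | j , vi≰1+vj = inj₂ (i , j , ≰⇒> vi≰1+vj)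

deficit<surplus : ∀ {n} (b t : Vec ℕ n) → Balanced t → ∀ {i j} →
  lookup t i < lookup b i → lookup b j < lookup t j → lookup b j < lookup b i
deficit<surplus b t t-balanced {i} {j} ti<bi bj<tj = ≤-trans bj<tj (≤-trans (t-balanced j i) ti<bi)

N₁-≤-balanced : ∀ {n} (a : Vec ℕ n) {b t : Vec ℕ n} → Balanced t → sum b ≡ sum t → N₁ a b ≤ N₁ a t
N₁-≤-balanced a {b} {t} t-balanced = moveUnit-induction t (λ b → N₁ a b ≤ N₁ a t) ≤-refl step b
  where
  step : ∀ b i j → lookup t i < lookup b i → lookup b j < lookup t j →
    N₁ a (moveUnit b i j) ≤ N₁ a t → N₁ a b ≤ N₁ a t
  step b i j ti<bi bj<tj ih = ≤-trans (N₁-moveUnit-≤ a b (deficit<surplus b t t-balanced ti<bi bj<tj)) ih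

N₁-<-balanced : ∀ {n} {a b t : Vec ℕ n} → LoopDigraphic a b → Unbalanced b →
  Balanced t → sum b ≡ sum t → N₁ a b < N₁ a t
N₁-<-balanced {a = a} {b} ld (i , j , gap) t-balanced Σb≡Σt = <-≤-trans (N₁-moveUnit-< ld gap)
  (N₁-≤-balanced a t-balanced (trans (sum-moveUnit b (gap⇒≢ b bj<bi) (≤-<-trans z≤n bj<bi)) Σb≡Σt))
  where bj<bi = ≤-trans (n≤1+n _) gap

N₁-<-balancing : ∀ {n} {a b s t : Vec ℕ n} → LoopDigraphic a b → Balanced s → Balanced t →
  sum a ≡ sum s → sum b ≡ sum t → Unbalanced a ⊎ Unbalanced b → N₁ a b < N₁ s t
N₁-<-balancing {a = a} {b} {s} {t} (M , R) s-balanced t-balanced Σa≡Σs Σb≡Σt (inj₁ a-unbalanced) = begin-strict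
  N₁ a b ≡⟨ N₁-comm a b ⟩
  N₁ b a <⟨ N₁-<-balanced (transpose M , transpose-realization R) a-unbalanced s-balanced Σa≡Σs ⟩
  N₁ b s ≡⟨ N₁-comm b s ⟩
  N₁ s b ≤⟨ N₁-≤-balanced s t-balanced Σb≡Σt ⟩
  N₁ s t ∎
  where open ≤-Reasoning
N₁-<-balancing {a = a} {b} {s} {t} ld s-balanced t-balanced Σa≡Σs Σb≡Σt (inj₂ b-unbalanced) = begin-strict
  N₁ a b <⟨ N₁-<-balanced ld b-unbalanced t-balanced Σb≡Σt ⟩
  N₁ a t ≡⟨ N₁-comm a t ⟩
  N₁ t a ≤⟨ N₁-≤-balanced t s-balanced Σa≡Σs ⟩
  N₁ t s ≡⟨ N₁-comm t s ⟩
  N₁ s t ∎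
  where open ≤-Reasoning

lookup-permuteVec : ∀ {n} (σ : Permutation′ n) (v : Vec ℕ n) k → lookup (permuteVec σ v) k ≡ lookup v (σ ⟨$⟩ʳ k)
lookup-permuteVec σ v = lookup∘tabulate (λ k → lookup v (σ ⟨$⟩ʳ k))

permuteVec-id : ∀ {n} (v : Vec ℕ n) → permuteVec Perm.id v ≡ v
permuteVec-id v = lookup-ext (lookup-permuteVec Perm.id v)

permuteVec-∘ₚ : ∀ {n} (σ τ : Permutation′ n) (v : Vec ℕ n) →
  permuteVec (σ ∘ₚ τ) v ≡ permuteVec σ (permuteVec τ v)
permuteVec-∘ₚ σ τ v = lookup-ext λ k → begin
  lookup (permuteVec (σ ∘ₚ τ) v) k      ≡⟨ lookup-permuteVec (σ ∘ₚ τ) v k ⟩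
  lookup v (τ ⟨$⟩ʳ (σ ⟨$⟩ʳ k))          ≡⟨ lookup-permuteVec τ v (σ ⟨$⟩ʳ k) ⟨
  lookup (permuteVec τ v) (σ ⟨$⟩ʳ k)    ≡⟨ lookup-permuteVec σ (permuteVec τ v) k ⟨
  lookup (permuteVec σ (permuteVec τ v)) k ∎
  where open ≡-Reasoning

permuteVec-flip : ∀ {n} (σ : Permutation′ n) (v : Vec ℕ n) → permuteVec (flip σ) (permuteVec σ v) ≡ v
permuteVec-flip σ v = lookup-ext λ k →
  trans (lookup-permuteVec (flip σ) (permuteVec σ v) k) (trans (lookup-permuteVec σ v _) (cong (lookup v) (inverseʳ σ)))

sum-permuteVec : ∀ {n} (σ : Permutation′ n) (v : Vec ℕ n) → sum (permuteVec σ v) ≡ sum v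
sum-permuteVec σ v = begin
  sum (permuteVec σ v)              ≡⟨ sum-tabulate (λ k → lookup v (σ ⟨$⟩ʳ k)) ⟩
  ∑.sum (λ k → lookup v (σ ⟨$⟩ʳ k)) ≡⟨ ∑.sum-permute (lookup v) σ ⟨
  ∑.sum (lookup v)                  ≡⟨ sum≡∑lookup v ⟨
  sum v                             ∎
  where open ≡-Reasoning

balanced-permuteVec : ∀ {n} (σ : Permutation′ n) {v : Vec ℕ n} → Balanced v → Balanced (permuteVec σ v)
balanced-permuteVec σ {v} v-balanced i j =
  subst₂ _≤_ (sym (lookup-permuteVec σ v i)) (cong suc (sym (lookup-permuteVec σ v j))) (v-balanced _ _)

moveUnit≡permuteVec-transpose : ∀ {n} (b : Vec ℕ n) {i j} → lookup b i ≡ suc (lookup b j) →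
  moveUnit b i j ≡ permuteVec (Perm.transpose i j) b
moveUnit≡permuteVec-transpose b {i} {j} bi≡1+bj = lookup-ext λ k → trans (entry k) (sym (lookup-permuteVec τ b k))
  where
  τ = Perm.transpose i j
  i≢j : i ≢ j
  i≢j refl = 1+n≢n (sym bi≡1+bj)
  entry : ∀ k → lookup (moveUnit b i j) k ≡ lookup b (τ ⟨$⟩ʳ k)
  entry k with k ≟ᶠ i | k ≟ᶠ j
  ... | yes refl | _        = trans (lookup-replaceTwo-i b _ _ i≢j) (cong pred bi≡1+bj)
  ... | no _     | yes refl rewrite dec-true (k ≟ᶠ k) refl = trans (lookup-replaceTwo-j b _ _) (sym bi≡1+bj)
  ... | no k≢i   | no k≢j   rewrite dec-false (k ≟ᶠ j) k≢j = lookup-replaceTwo-other b _ _ k≢i k≢j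

balanced-permutation : ∀ {n} {t : Vec ℕ n} → Balanced t → ∀ b → sum b ≡ sum t → Balanced b →
  ∃ λ (σ : Permutation′ n) → b ≡ permuteVec σ t
balanced-permutation {n} {t} t-balanced = moveUnit-induction t P (λ _ → Perm.id , sym (permuteVec-id t)) step
  where
  P : Vec ℕ n → Set
  P b = Balanced b → ∃ λ (σ : Permutation′ n) → b ≡ permuteVec σ t
  step : ∀ b i j → lookup t i < lookup b i → lookup b j < lookup t j → P (moveUnit b i j) → P b
  step b i j ti<bi bj<tj ih b-balanced = flip τ ∘ₚ σ , (begin
    b                                    ≡⟨ permuteVec-flip τ b ⟨
    permuteVec (flip τ) (permuteVec τ b) ≡⟨ cong (permuteVec (flip τ)) τb≡σt ⟩
    permuteVec (flip τ) (permuteVec σ t) ≡⟨ permuteVec-∘ₚ (flip τ) σ t ⟨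
    permuteVec (flip τ ∘ₚ σ) t           ∎)
    where
    open ≡-Reasoning
    τ = Perm.transpose i j
    bi≡1+bj : lookup b i ≡ suc (lookup b j)
    bi≡1+bj = ≤-antisym (b-balanced i j) (deficit<surplus b t t-balanced ti<bi bj<tj)
    moved≡τb = moveUnit≡permuteVec-transpose b bi≡1+bj
    moved-balanced : Balanced (moveUnit b i j)
    moved-balanced = subst Balanced (sym moved≡τb) (balanced-permuteVec τ {b} b-balanced)
    σ = proj₁ (ih moved-balanced)
    τb≡σt : permuteVec τ b ≡ permuteVec σ t
    τb≡σt = trans (sym moved≡τb) (proj₂ (ih moved-balanced))

balanced-nonIncreasing-unique : ∀ {n} {u v : Vec ℕ n} → NonIncreasing u → NonIncreasing v →
  Balanced u → Balanced v → sum u ≡ sum v → u ≡ v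
balanced-nonIncreasing-unique {u = u} {v} u↓ v↓ u-balanced v-balanced Σu≡Σv with ≡⊎surplus×deficit u v Σu≡Σv
... | inj₁ u≡v = u≡v
... | inj₂ (i , j , vi<ui , uj<vj) with ≤-total (toℕ i) (toℕ j)
...   | inj₁ i≤j = ⊥-elim (<-irrefl refl (≤-trans vi<ui (≤-trans (u-balanced i j) (≤-trans uj<vj (v↓ i j i≤j)))))
...   | inj₂ j≤i = ⊥-elim (<-irrefl refl (≤-trans uj<vj (≤-trans (v-balanced j i) (≤-trans vi<ui (u↓ j i j≤i)))))

indicator : Bool → ℕ
indicator b = if b then 1 else 0

indicator-≤1 : ∀ b → indicator b ≤ 1
indicator-≤1 true  = ≤-refl
indicator-≤1 false = z≤n

indicator-<ᵇ-antitone : ∀ {x y} r → x ≤ y → indicator (y <ᵇ r) ≤ indicator (x <ᵇ r)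
indicator-<ᵇ-antitone zero    _         = z≤n
indicator-<ᵇ-antitone {zero}  {y} (suc r) _ = indicator-≤1 (y <ᵇ suc r)
indicator-<ᵇ-antitone {suc x} {suc y} (suc r) (s≤s x≤y) = indicator-<ᵇ-antitone r x≤y

sum-indicator-<ᵇ : ∀ n r → r ≤ n → sum (tabulate {n = n} (λ i → indicator (toℕ i <ᵇ r))) ≡ r
sum-indicator-<ᵇ zero    zero    _         = refl
sum-indicator-<ᵇ (suc n) zero    _         = sum-indicator-<ᵇ n zero z≤n
sum-indicator-<ᵇ (suc n) (suc r) (s≤s r≤n) = cong suc (sum-indicator-<ᵇ n r r≤n)

sum-tabulate-+ : ∀ n q (f : Fin n → ℕ) → sum (tabulate (λ i → q + f i)) ≡ n * q + sum (tabulate f)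
sum-tabulate-+ zero    q f = refl
sum-tabulate-+ (suc n) q f =
  trans (cong (q + f zero +_) (sum-tabulate-+ n q (f ∘ suc))) (interchange q (f zero) (n * q) _)

lookup-α : ∀ k m i → lookup (α (suc k) m) i ≡ m / suc k + indicator (toℕ i <ᵇ m % suc k)
lookup-α k m = lookup∘tabulate (λ i → m / suc k + indicator (toℕ i <ᵇ m % suc k))

α-balanced : ∀ n m → Balanced (α n m)
α-balanced (suc k) m i j rewrite lookup-α k m i | lookup-α k m j = begin
  m / suc k + indicator (toℕ i <ᵇ m % suc k) ≤⟨ +-monoʳ-≤ (m / suc k) (indicator-≤1 _) ⟩
  m / suc k + 1                              ≡⟨ +-comm (m / suc k) 1 ⟩
  suc (m / suc k)                            ≤⟨ s≤s (m≤m+n _ _) ⟩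
  suc (m / suc k + indicator (toℕ j <ᵇ m % suc k)) ∎
  where open ≤-Reasoning

α-nonIncreasing : ∀ n m → NonIncreasing (α n m)
α-nonIncreasing (suc k) m i j i≤j rewrite lookup-α k m i | lookup-α k m j =
  +-monoʳ-≤ (m / suc k) (indicator-<ᵇ-antitone (m % suc k) i≤j)

-- The bound m ≤ n * n only matters for n = 0, where α is empty.
sum-α : ∀ n m → m ≤ n * n → sum (α n m) ≡ m
sum-α zero    zero    _ = refl
sum-α (suc k) m       _ = begin
  sum (α (suc k) m)
    ≡⟨ sum-tabulate-+ (suc k) (m / suc k) (λ i → indicator (toℕ i <ᵇ m % suc k)) ⟩
  suc k * (m / suc k) + sum (tabulate {n = suc k} λ i → indicator (toℕ i <ᵇ m % suc k))
                                                   ≡⟨ cong (suc k * (m / suc k) +_)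
                                                        (sum-indicator-<ᵇ (suc k) (m % suc k) (<⇒≤ (m%n<n m (suc k)))) ⟩
  suc k * (m / suc k) + m % suc k                  ≡⟨ +-comm (suc k * (m / suc k)) (m % suc k) ⟩
  m % suc k + suc k * (m / suc k)                  ≡⟨ cong (m % suc k +_) (*-comm (suc k) (m / suc k)) ⟩
  m % suc k + m / suc k * suc k                    ≡⟨ m≡m%n+[m/n]*n m (suc k) ⟨
  m                                                ∎
  where open ≡-Reasoning

sum-α-sum : ∀ {n} {a b : Vec ℕ n} → LoopDigraphic a b → sum (α n (sum a)) ≡ sum a
sum-α-sum {n} ld = sum-α n _ (subst (_≤ n * n) (realization-sum ld) (realization-sum-≤ ld))

balanced-minconvex : ∀ {n} {a b : Vec ℕ n} → LoopDigraphic a b → NonIncreasing a → Balanced a → Balanced b →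
  IsMinconvex a b
balanced-minconvex {n} {a} {b} ld a↓ a-balanced b-balanced =
  sum a , subst (_≤ n * n) (realization-sum ld) (realization-sum-≤ ld) , proj₁ b≈α , a≡α , proj₂ b≈α
  where
  a≡α = balanced-nonIncreasing-unique {v = α n (sum a)} a↓ (α-nonIncreasing n _) a-balanced (α-balanced n _)
          (sym (sum-α-sum ld))
  b≈α = balanced-permutation {t = α n (sum a)} (α-balanced n (sum a)) b
          (trans (realization-sum ld) (sym (sum-α-sum ld))) b-balanced

corollary3 : (n m : ℕ) (a b : Vec ℕ n) → LoopDigraphic a b → NonIncreasing a → sum a ≡ m → ¬ IsMinconvex a b → (σ : Permutation′ n) → N₁ a b < N₁ (α n m) (permuteVec σ (α n m))
corollary3 n _ a b ld a↓ refl ¬minconvex σ =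
  N₁-<-balancing {s = α′} ld (α-balanced n (sum a)) (balanced-permuteVec σ {α′} (α-balanced n (sum a)))
    (sym (sum-α-sum ld)) (trans (realization-sum ld) (sym (trans (sum-permuteVec σ α′) (sum-α-sum ld))))
    unbalanced
  where
  α′ = α n (sum a)
  unbalanced : Unbalanced a ⊎ Unbalanced b
  unbalanced with balanced⊎unbalanced a | balanced⊎unbalanced b
  ... | inj₂ a-unbalanced | _                 = inj₁ a-unbalanced
  ... | inj₁ _            | inj₂ b-unbalanced = inj₂ b-unbalanced
  ... | inj₁ a-balanced   | inj₁ b-balanced   = ⊥-elim (¬minconvex (balanced-minconvex ld a↓ a-balanced b-balanced))
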